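{- Let $n$ be a positive integer and $\mathbf{C}$ the class of all potentially partial recursive $n$-ary functions. Then every finite collection of recursively enumerable subsets of $\mathbb{N}^n$ is strongly join permitting for $\mathbf{C}$.
   Context: Functions are sets of ordered pairs; $f\!\upharpoonright_A$ is the restriction of $f$ to $A\cap\mathrm{dom}(f)$. A partial function from $\mathbb{N}^n$ to $\mathbb{N}$ is potentially partial recursive if it is a restriction of some $n$-ary partial recursive function. A collection $\mathcal{A}$ of sets is strongly join permitting for $\mathbf{C}$ if for every function $f$ with $\mathrm{dom}(f)\subseteq\bigcup\mathcal{A}$: if $f\!\upharpoonright_A\in\mathbf{C}$ for all $A\in\mathcal{A}$, then $f\in\mathbf{C}$. -}

module Defs where

open import Data.Nat using (ℕ; zero; suc; _<_)
open import Data.Fin using (Fin)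
open import Data.Vec using (Vec; []; _∷_; lookup)
open import Data.Product using (Σ; ∃; _×_)
open import Relation.Binary.PropositionalEquality using (_≡_)

data PRF : ℕ → Set where
  zer  : PRF 0
  sc   : PRF 1
  proj : ∀ {n} → Fin n → PRF n
  comp : ∀ {k m} → PRF k → Vec (PRF m) k → PRF m
  prec : ∀ {n} → PRF n → PRF (suc (suc n)) → PRF (suc n)
    -- h(0,x) = f(x), h(t+1,x) = g(t, h(t,x), x)
  mu   : ∀ {n} → PRF (suc n) → PRF n
    -- μ y. f(y,x) = 0

mutual
  data Eval : ∀ {n} → PRF n → Vec ℕ n → ℕ → Set where
    ev-zer  : Eval zer [] 0
    ev-sc   : ∀ {x} → Eval sc (x ∷ []) (suc x)
    ev-proj : ∀ {n} {i : Fin n} {xs} → Eval (proj i) xs (lookup xs i)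
    ev-comp : ∀ {k m} {f : PRF k} {gs : Vec (PRF m) k} {xs ys y} →
              EvalAll gs xs ys → Eval f ys y → Eval (comp f gs) xs y
    ev-prec0 : ∀ {n} {f : PRF n} {g} {xs y} →
               Eval f xs y → Eval (prec f g) (0 ∷ xs) y
    ev-precS : ∀ {n} {f : PRF n} {g} {t xs z y} →
               Eval (prec f g) (t ∷ xs) z → Eval g (t ∷ z ∷ xs) y →
               Eval (prec f g) (suc t ∷ xs) y
    ev-mu   : ∀ {n} {f : PRF (suc n)} {xs y} →
              Eval f (y ∷ xs) 0 →
              ((z : ℕ) → z < y → Σ ℕ (λ w → Eval f (z ∷ xs) (suc w))) →
              Eval (mu f) xs y

  data EvalAll : ∀ {k m} → Vec (PRF m) k → Vec ℕ m → Vec ℕ k → Set where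
    []  : ∀ {m} {xs : Vec ℕ m} → EvalAll [] xs []
    _∷_ : ∀ {k m} {g : PRF m} {gs : Vec (PRF m) k} {xs y ys} →
          Eval g xs y → EvalAll gs xs ys → EvalAll (g ∷ gs) xs (y ∷ ys)

Subset : ℕ → Set₁
Subset n = Vec ℕ n → Set

PFun : ℕ → Set₁
PFun n = Vec ℕ n → ℕ → Set

IsFunction : ∀ {n} → PFun n → Set
IsFunction f = ∀ x y z → f x y → f x z → y ≡ z

_↾_ : ∀ {n} → PFun n → Subset n → PFun n
(f ↾ A) x y = A x × f x y

-- f is potentially partial recursive: f is a restriction of some partial
-- recursive function, i.e. f ⊆ graph of some code e.
PotPR : ∀ {n} → PFun n → Set
PotPR {n} f = Σ (PRF n) (λ e → ∀ x y → f x y → Eval e x y)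

IsRE : ∀ {n} → Subset n → Set
IsRE {n} A = Σ (PRF n) (λ e → ∀ x → (A x → ∃ (λ y → Eval e x y)) × (∃ (λ y → Eval e x y) → A x))

StronglyJoinPermitting : ∀ {n k} → (PFun n → Set) → (Fin k → Subset n) → Set₁
StronglyJoinPermitting {n} C 𝒜 =
  (f : PFun n) → IsFunction f →
  (∀ x y → f x y → ∃ (λ i → 𝒜 i x)) →
  (∀ i → C (f ↾ 𝒜 i)) →
  C f

-- Since 𝒜 i is the domain of a code aᵢ and f↾𝒜 i is extended by a code eᵢ, the code
-- "aᵢ and then eᵢ" halts exactly where both do, with eᵢ's value. A step-indexed evaluator
-- run, which is itself computed by a total partial recursive code, lets one μ-search for the
-- least clock at which one of these k codes has produced a value, and output that value
-- (dovetailing). If f x = y then x ∈ 𝒜 j for some j, so the search halts; the index i it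
-- finds has x ∈ 𝒜 i, hence eᵢ(x) = y, since eᵢ extends f↾𝒜 i and evaluation is deterministic.
module Submission where

open import Defs
open import Data.Nat using (ℕ; zero; suc; pred; _+_; _≤_; _<_; _⊔_; s≤s)
open import Data.Nat.Properties
open import Data.Nat.Induction using (<-wellFounded)
open import Data.Fin using (Fin; zero; suc; _↑ʳ_)
open import Data.Vec using (Vec; []; _∷_; head; tail; lookup; tabulate; map; drop)
open import Data.Vec.Properties using (tabulate∘lookup)
open import Data.Product using (Σ; ∃; ∃₂; _×_; _,_; proj₁; proj₂)
open import Data.Sum using (inj₁; inj₂)
open import Data.Empty using (⊥-elim)
open import Function using (_∘_; id)
open import Induction.WellFounded using (Acc; acc)
open import Relation.Binary.PropositionalEquality
open import Relation.Nullary using (¬_; yes; no)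
import Relation.Unary as U

Computable : (m : ℕ) → (Vec ℕ m → ℕ) → Set
Computable m f = Σ (PRF m) λ c → ∀ xs → Eval c xs (f xs)

Computables : (m k : ℕ) → (Vec ℕ m → Vec ℕ k) → Set
Computables m k F = Σ (Vec (PRF m) k) λ cs → ∀ xs → EvalAll cs xs (F xs)

module _ {m : ℕ} where

  Computable-≗ : ∀ {f g} → Computable m f → f ≗ g → Computable m g
  Computable-≗ (c , ok) f≗g = c , λ xs → subst (Eval c xs) (f≗g xs) (ok xs)

  Computables-≗ : ∀ {k F G} → Computables m k F → F ≗ G → Computables m k G
  Computables-≗ (cs , ok) F≗G = cs , λ xs → subst (EvalAll cs xs) (F≗G xs) (ok xs)

  []ᶜ : Computables m 0 (λ _ → [])
  []ᶜ = [] , λ _ → []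

  infixr 5 _∷ᶜ_
  _∷ᶜ_ : ∀ {k f F} → Computable m f → Computables m k F →
         Computables m (suc k) (λ xs → f xs ∷ F xs)
  (c , ok) ∷ᶜ (cs , oks) = c ∷ cs , λ xs → ok xs ∷ oks xs

  infixr 9 _∘ᶜ_
  _∘ᶜ_ : ∀ {k f F} → Computable k f → Computables m k F → Computable m (f ∘ F)
  (c , ok) ∘ᶜ (cs , oks) = comp c cs , λ xs → ev-comp (oks xs) (ok _)

  mapᶜ : ∀ {k h F} → Computable 1 (h ∘ head) → Computables m k F →
         Computables m k (map h ∘ F)
  mapᶜ {h = h} (c , ok) (cs , oks) = map (λ d → comp c (d ∷ [])) cs , λ xs → go (oks xs)
    where
    go : ∀ {k} {ds : Vec (PRF m) k} {xs ys} → EvalAll ds xs ys →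
         EvalAll (map (λ d → comp c (d ∷ [])) ds) xs (map h ys)
    go []         = []
    go (ev ∷ evs) = ev-comp (ev ∷ []) (ok _) ∷ go evs

  projᶜ : (i : Fin m) → Computable m (λ xs → lookup xs i)
  projᶜ i = proj i , λ _ → ev-proj

  lookupsᶜ : ∀ {k} (σ : Fin k → Fin m) → Computables m k (λ xs → tabulate (lookup xs ∘ σ))
  lookupsᶜ {zero}  σ = []ᶜ
  lookupsᶜ {suc k} σ = projᶜ (σ zero) ∷ᶜ lookupsᶜ (σ ∘ suc)

  constᶜ : (c : ℕ) → Computable m (λ _ → c)
  constᶜ zero    = comp zer [] , λ _ → ev-comp [] ev-zer
  constᶜ (suc c) = let (d , ok) = constᶜ c in
    comp sc (d ∷ []) , λ xs → ev-comp (ok xs ∷ []) ev-sc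

  sucᶜ : ∀ {f} → Computable m f → Computable m (suc ∘ f)
  sucᶜ (c , ok) = comp sc (c ∷ []) , λ xs → ev-comp (ok xs ∷ []) ev-sc

tabulate-lookup-↑ʳ : ∀ j {m} (xs : Vec ℕ (j + m)) → tabulate (lookup xs ∘ (j ↑ʳ_)) ≡ drop j xs
tabulate-lookup-↑ʳ zero    xs       = tabulate∘lookup xs
tabulate-lookup-↑ʳ (suc j) (x ∷ xs) = tabulate-lookup-↑ʳ j xs

dropᶜ : ∀ j {m} → Computables (j + m) m (drop j)
dropᶜ j = Computables-≗ (lookupsᶜ (j ↑ʳ_)) (tabulate-lookup-↑ʳ j)

idᶜ : ∀ {m} → Computables m m id
idᶜ = dropᶜ 0

primrec : ∀ {n} → (Vec ℕ n → ℕ) → (Vec ℕ (suc (suc n)) → ℕ) → Vec ℕ (suc n) → ℕ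
primrec f g (zero  ∷ xs) = f xs
primrec f g (suc s ∷ xs) = g (s ∷ primrec f g (s ∷ xs) ∷ xs)

primrecᶜ : ∀ {n f g} → Computable n f → Computable (suc (suc n)) g →
           Computable (suc n) (primrec f g)
primrecᶜ {f = f} {g} (cf , okf) (cg , okg) = prec cf cg , ok
  where
  ok : ∀ xs → Eval (prec cf cg) xs (primrec f g xs)
  ok (zero  ∷ xs) = ev-prec0 (okf xs)
  ok (suc s ∷ xs) = ev-precS (ok (s ∷ xs)) (okg _)

ifZero : ℕ → ℕ → ℕ → ℕ
ifZero zero    a b = a
ifZero (suc _) a b = b

ifZeroᶜ : ∀ {m c a b} → Computable m c → Computable m a → Computable m b →
          Computable m (λ xs → ifZero (c xs) (a xs) (b xs))
ifZeroᶜ C A B = Computable-≗ (primrecᶜ (projᶜ zero) (projᶜ (suc (suc (suc zero))))) ifZero-primrec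
                  ∘ᶜ (C ∷ᶜ A ∷ᶜ B ∷ᶜ []ᶜ)
  where
  ifZero-primrec : ∀ v → primrec (λ ys → lookup ys zero) (λ ys → lookup ys (suc (suc (suc zero)))) v
                         ≡ ifZero (head v) (head (tail v)) (head (tail (tail v)))
  ifZero-primrec (zero  ∷ _ ∷ _ ∷ []) = refl
  ifZero-primrec (suc _ ∷ _ ∷ _ ∷ []) = refl

predᶜ : Computable 1 (pred ∘ head)
predᶜ = Computable-≗ (primrecᶜ (constᶜ 0) (projᶜ zero)) primrec-pred
  where
  primrec-pred : ∀ v → primrec (λ _ → 0) (λ ys → lookup ys zero) v ≡ pred (head v)
  primrec-pred (zero  ∷ []) = refl
  primrec-pred (suc _ ∷ []) = refl

allNonZero : ∀ {k} → Vec ℕ k → ℕ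
allNonZero []       = 1
allNonZero (v ∷ vs) = ifZero v 0 (allNonZero vs)

allNonZeroᶜ : ∀ k → Computable k allNonZero
allNonZeroᶜ zero    = Computable-≗ (constᶜ 1) λ { [] → refl }
allNonZeroᶜ (suc k) = Computable-≗ (ifZeroᶜ (projᶜ zero) (constᶜ 0) (allNonZeroᶜ k ∘ᶜ dropᶜ 1))
                        λ { (_ ∷ _) → refl }

-- Search states: 1 = still searching, suc (suc y) = found y, 0 = stuck at an argument
-- without a result.
searchStep : (state result b : ℕ) → ℕ
searchStep 1 0             b = 0
searchStep 1 1             b = suc (suc b)
searchStep 1 (suc (suc _)) b = 1
searchStep state _         _ = state

searchStepᶜ : ∀ {m s v b} → Computable m s → Computable m v → Computable m b →
              Computable m (λ xs → searchStep (s xs) (v xs) (b xs))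
searchStepᶜ {s = s} {v} {b} S V B =
  Computable-≗ (ifZeroᶜ S (constᶜ 0)
                 (ifZeroᶜ (predᶜ ∘ᶜ (S ∷ᶜ []ᶜ))
                   (ifZeroᶜ V (constᶜ 0) (ifZeroᶜ (predᶜ ∘ᶜ (V ∷ᶜ []ᶜ)) (sucᶜ (sucᶜ B)) (constᶜ 1)))
                   S))
               λ xs → ifZero-form (s xs) (v xs) (b xs)
  where
  ifZero-form : ∀ s v b →
    ifZero s 0 (ifZero (pred s) (ifZero v 0 (ifZero (pred v) (suc (suc b)) 1)) s) ≡ searchStep s v b
  ifZero-form 0             v             b = refl
  ifZero-form 1             0             b = refl
  ifZero-form 1             1             b = refl
  ifZero-form 1             (suc (suc v)) b = refl
  ifZero-form (suc (suc s)) v             b = refl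

-- run a t xs is suc v if evaluation with clock t finds a(xs) = v, and 0 if it finds nothing.
mutual
  run : ∀ {n} → PRF n → ℕ → Vec ℕ n → ℕ
  run zer         t xs       = 1
  run sc          t (x ∷ []) = suc (suc x)
  run (proj i)    t xs       = suc (lookup xs i)
  run (comp f gs) t xs       =
    ifZero (allNonZero (runAll gs t xs)) 0 (run f t (map pred (runAll gs t xs)))
  run (prec f g)  t (s ∷ xs) = primrec (runAt f) (recStep g) (s ∷ t ∷ xs)
  run (mu f)      t xs       = pred (primrec (λ _ → 1) (searchStepAt f) (t ∷ t ∷ xs))

  runAll : ∀ {k m} → Vec (PRF m) k → ℕ → Vec ℕ m → Vec ℕ k
  runAll []       t xs = []
  runAll (g ∷ gs) t xs = run g t xs ∷ runAll gs t xs

  runAt : ∀ {n} → PRF n → Vec ℕ (suc n) → ℕ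
  runAt f (t ∷ xs) = run f t xs

  recStep : ∀ {n} → PRF (suc (suc n)) → Vec ℕ (suc (suc (suc n))) → ℕ
  recStep g (s ∷ z ∷ t ∷ xs) = ifZero z 0 (run g t (s ∷ pred z ∷ xs))

  searchStepAt : ∀ {n} → PRF (suc n) → Vec ℕ (suc (suc (suc n))) → ℕ
  searchStepAt f (b ∷ state ∷ t ∷ xs) = searchStep state (run f t (b ∷ xs)) b

Clock : ∀ {n} → PRF n → Set
Clock {n} a = Computable (suc n) (runAt a)

Clocks : ∀ {k m} → Vec (PRF m) k → Set
Clocks {k} {m} gs = Computables (suc m) k λ v → runAll gs (head v) (tail v)

clock-comp : ∀ {k m} {f : PRF k} {gs : Vec (PRF m) k} → Clock f → Clocks gs → Clock (comp f gs)
clock-comp {k} Cf Cgs =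
  Computable-≗ (ifZeroᶜ (allNonZeroᶜ k ∘ᶜ Cgs) (constᶜ 0) (Cf ∘ᶜ (projᶜ zero ∷ᶜ mapᶜ predᶜ Cgs)))
               λ { (_ ∷ _) → refl }

clock-prec : ∀ {n} {f : PRF n} {g} → Clock f → Clock g → Clock (prec f g)
clock-prec {n} {g = g} Cf Cg =
  Computable-≗ (primrecᶜ Cf recStepᶜ ∘ᶜ (projᶜ (suc zero) ∷ᶜ projᶜ zero ∷ᶜ dropᶜ 2))
               λ { (_ ∷ _ ∷ _) → refl }
  where
  recStepᶜ : Computable (suc (suc (suc n))) (recStep g)
  recStepᶜ = Computable-≗
    (ifZeroᶜ (projᶜ (suc zero)) (constᶜ 0)
      (Cg ∘ᶜ (projᶜ (suc (suc zero)) ∷ᶜ projᶜ zero ∷ᶜ predᶜ ∘ᶜ (projᶜ (suc zero) ∷ᶜ []ᶜ)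
              ∷ᶜ dropᶜ 3)))
    λ { (_ ∷ _ ∷ _ ∷ _) → refl }

clock-mu : ∀ {n} {f : PRF (suc n)} → Clock f → Clock (mu f)
clock-mu {n} {f} Cf =
  Computable-≗ (predᶜ ∘ᶜ (primrecᶜ (constᶜ 1) searchStepAtᶜ ∘ᶜ (projᶜ zero ∷ᶜ idᶜ) ∷ᶜ []ᶜ))
               λ { (_ ∷ _) → refl }
  where
  searchStepAtᶜ : Computable (suc (suc (suc n))) (searchStepAt f)
  searchStepAtᶜ = Computable-≗
    (searchStepᶜ (projᶜ (suc zero))
                 (Cf ∘ᶜ (projᶜ (suc (suc zero)) ∷ᶜ projᶜ zero ∷ᶜ dropᶜ 3))
                 (projᶜ zero))
    λ { (_ ∷ _ ∷ _ ∷ _) → refl }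

mutual
  clock : ∀ {n} (a : PRF n) → Clock a
  clock zer         = Computable-≗ (constᶜ 1) λ { (_ ∷ []) → refl }
  clock sc          = Computable-≗ (sucᶜ (sucᶜ (projᶜ (suc zero)))) λ { (_ ∷ _ ∷ []) → refl }
  clock (proj i)    = Computable-≗ (sucᶜ (projᶜ (suc i))) λ { (_ ∷ _) → refl }
  clock (comp f gs) = clock-comp (clock f) (clocks gs)
  clock (prec f g)  = clock-prec (clock f) (clock g)
  clock (mu f)      = clock-mu (clock f)

  clocks : ∀ {k m} (gs : Vec (PRF m) k) → Clocks gs
  clocks []       = []ᶜ
  clocks (g ∷ gs) = Computables-≗ (clock g ∷ᶜ clocks gs) λ { (_ ∷ _) → refl }

searchState : ∀ {n} → PRF (suc n) → (t b : ℕ) → Vec ℕ n → ℕ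
searchState f t b xs = primrec (λ _ → 1) (searchStepAt f) (b ∷ t ∷ xs)

PositiveAt : ∀ {n} → PRF (suc n) → ℕ → Vec ℕ n → ℕ → Set
PositiveAt f t xs z = ∃ λ w → run f t (z ∷ xs) ≡ suc (suc w)

LeastZeroAt : ∀ {n} → PRF (suc n) → ℕ → Vec ℕ n → ℕ → Set
LeastZeroAt f t xs y = run f t (y ∷ xs) ≡ 1 × (∀ z → z < y → PositiveAt f t xs z)

module _ {n} (f : PRF (suc n)) (t : ℕ) (xs : Vec ℕ n) where

  searching⇒positive : ∀ b → searchState f t b xs ≡ 1 → ∀ z → z < b → PositiveAt f t xs z
  searching⇒positive (suc b) e z z<1+b with searchState f t b xs in e₁ | run f t (b ∷ xs) in e₂
  searching⇒positive (suc b) () z z<1+b | 1 | 0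
  searching⇒positive (suc b) () z z<1+b | 1 | 1
  ... | 1 | suc (suc w) with m<1+n⇒m<n∨m≡n z<1+b
  ...   | inj₁ z<b  = searching⇒positive b e₁ z z<b
  ...   | inj₂ refl = w , e₂
  searching⇒positive (suc b) () z z<1+b | 0 | _
  searching⇒positive (suc b) () z z<1+b | suc (suc _) | _

  found⇒leastZero : ∀ b {y} → searchState f t b xs ≡ suc (suc y) → y < b × LeastZeroAt f t xs y
  found⇒leastZero (suc b) e with searchState f t b xs in e₁ | run f t (b ∷ xs) in e₂
  found⇒leastZero (suc b) refl | 1 | 1 = ≤-refl , e₂ , searching⇒positive b e₁
  found⇒leastZero (suc b) refl | suc (suc y) | _ =
    let y<b , least = found⇒leastZero b e₁ in m≤n⇒m≤1+n y<b , least
  found⇒leastZero (suc b) () | 1 | 0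
  found⇒leastZero (suc b) () | 1 | suc (suc _)
  found⇒leastZero (suc b) () | 0 | _

  positive⇒searching : ∀ {y} → (∀ z → z < y → PositiveAt f t xs z) →
                       ∀ b → b ≤ y → searchState f t b xs ≡ 1
  positive⇒searching pos zero    _     = refl
  positive⇒searching pos (suc b) 1+b≤y
    rewrite positive⇒searching pos b (≤-trans (n≤1+n b) 1+b≤y) | proj₂ (pos b 1+b≤y) = refl

  leastZero⇒found : ∀ {y} → LeastZeroAt f t xs y →
                    ∀ b → y < b → searchState f t b xs ≡ suc (suc y)
  leastZero⇒found {y} (zero-at-y , pos) (suc b) (s≤s y≤b) with m≤n⇒m<n∨m≡n y≤b
  ... | inj₁ y<b  rewrite leastZero⇒found (zero-at-y , pos) b y<b = refl
  ... | inj₂ refl rewrite positive⇒searching pos y ≤-refl | zero-at-y = refl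

pred≡suc⇒≡2+ : ∀ m {y} → pred m ≡ suc y → m ≡ suc (suc y)
pred≡suc⇒≡2+ (suc (suc m)) refl = refl

mutual
  run-sound : ∀ {n} (a : PRF n) t xs {v} → run a t xs ≡ suc v → Eval a xs v
  run-sound zer      t []       refl = ev-zer
  run-sound sc       t (x ∷ []) refl = ev-sc
  run-sound (proj i) t xs       refl = ev-proj
  run-sound (comp f gs) t xs r with allNonZero (runAll gs t xs) in nz
  run-sound (comp f gs) t xs () | zero
  ... | suc _ = ev-comp (runAll-sound gs t xs nz) (run-sound f t _ r)
  run-sound (prec f g) t (s ∷ xs) r = prec-sound f g t s xs r
  run-sound (mu f) t xs r with found⇒leastZero f t xs t (pred≡suc⇒≡2+ (searchState f t t xs) r)
  ... | _ , zero-at-y , pos =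
    ev-mu (run-sound f t _ zero-at-y)
          λ z z<y → proj₁ (pos z z<y) , run-sound f t _ (proj₂ (pos z z<y))

  runAll-sound : ∀ {k m} (gs : Vec (PRF m) k) t xs {w} → allNonZero (runAll gs t xs) ≡ suc w →
                 EvalAll gs xs (map pred (runAll gs t xs))
  runAll-sound []       t xs _ = []
  runAll-sound (g ∷ gs) t xs nz with run g t xs in r
  runAll-sound (g ∷ gs) t xs () | zero
  ... | suc _ = run-sound g t xs r ∷ runAll-sound gs t xs nz

  prec-sound : ∀ {n} (f : PRF n) g t s xs {v} → run (prec f g) t (s ∷ xs) ≡ suc v →
               Eval (prec f g) (s ∷ xs) v
  prec-sound f g t zero    xs r = ev-prec0 (run-sound f t xs r)
  prec-sound f g t (suc s) xs r with run (prec f g) t (s ∷ xs) in r₀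
  prec-sound f g t (suc s) xs () | zero
  ... | suc _ = ev-precS (prec-sound f g t s xs r₀) (run-sound g t _ r)

Eventually : (ℕ → Set) → Set
Eventually P = ∃ λ t → ∀ {t′} → t ≤ t′ → P t′

module _ {P Q : ℕ → Set} where

  eventually-map : (∀ {t} → P t → Q t) → Eventually P → Eventually Q
  eventually-map P⇒Q (t , p) = t , P⇒Q ∘ p

  infixr 4 _∧ᵉ_
  _∧ᵉ_ : Eventually P → Eventually Q → Eventually (λ t → P t × Q t)
  (t₁ , p) ∧ᵉ (t₂ , q) =
    t₁ ⊔ t₂ , λ le → p (≤-trans (m≤m⊔n t₁ t₂) le) , q (≤-trans (m≤n⊔m t₁ t₂) le)

eventually-∀< : ∀ {P : ℕ → ℕ → Set} y → (∀ z → z < y → Eventually (P z)) →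
                Eventually (λ t → ∀ z → z < y → P z t)
eventually-∀< zero    _  = 0 , λ _ _ ()
eventually-∀< {P} (suc y) ev =
  eventually-map extend (eventually-∀< y (λ z z<y → ev z (m≤n⇒m≤1+n z<y)) ∧ᵉ ev y ≤-refl)
  where
  extend : ∀ {t} → (∀ z → z < y → P z t) × P y t → ∀ z → z < suc y → P z t
  extend (below , at-y) z z<1+y with m<1+n⇒m<n∨m≡n z<1+y
  ... | inj₁ z<y  = below z z<y
  ... | inj₂ refl = at-y

allNonZero-map-suc : ∀ {k} (ys : Vec ℕ k) → allNonZero (map suc ys) ≡ 1
allNonZero-map-suc []       = refl
allNonZero-map-suc (_ ∷ ys) = allNonZero-map-suc ys

map-pred-map-suc : ∀ {k} (ys : Vec ℕ k) → map pred (map suc ys) ≡ ys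
map-pred-map-suc []       = refl
map-pred-map-suc (y ∷ ys) = cong (y ∷_) (map-pred-map-suc ys)

mutual
  run-complete : ∀ {n} {a : PRF n} {xs v} → Eval a xs v → Eventually (λ t → run a t xs ≡ suc v)
  run-complete ev-zer  = 0 , λ _ → refl
  run-complete ev-sc   = 0 , λ _ → refl
  run-complete ev-proj = 0 , λ _ → refl
  run-complete {xs = xs} {v} (ev-comp {f = f} {gs} {ys = ys} evs ev) =
    eventually-map step (runAll-complete evs ∧ᵉ run-complete ev)
    where
    step : ∀ {t} → runAll gs t xs ≡ map suc ys × run f t ys ≡ suc v → run (comp f gs) t xs ≡ suc v
    step (rs , r) rewrite rs | allNonZero-map-suc ys | map-pred-map-suc ys = r
  run-complete (ev-prec0 ev) = run-complete ev
  run-complete {v = v} (ev-precS {f = f} {g} {t = s} {xs} {z} evₛ ev) =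
    eventually-map step (run-complete evₛ ∧ᵉ run-complete ev)
    where
    step : ∀ {t} → run (prec f g) t (s ∷ xs) ≡ suc z × run g t (s ∷ z ∷ xs) ≡ suc v →
           run (prec f g) t (suc s ∷ xs) ≡ suc v
    step (rₛ , r) rewrite rₛ = r
  run-complete (ev-mu {f = f} {xs} {y} ev₀ positive) =
    eventually-map found ((run-complete ev₀ ∧ᵉ eventually-∀< y positive-below) ∧ᵉ (suc y , id))
    where
    positive-below : ∀ z → z < y → Eventually (λ t → PositiveAt f t xs z)
    positive-below z z<y =
      eventually-map (proj₁ (positive z z<y) ,_) (run-complete (proj₂ (positive z z<y)))
    found : ∀ {t} → LeastZeroAt f t xs y × y < t → run (mu f) t xs ≡ suc y
    found {t} (leastZero , y<t) = cong pred (leastZero⇒found f t xs leastZero t y<t)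

  runAll-complete : ∀ {k m} {gs : Vec (PRF m) k} {xs ys} → EvalAll gs xs ys →
                    Eventually (λ t → runAll gs t xs ≡ map suc ys)
  runAll-complete []         = 0 , λ _ → refl
  runAll-complete (ev ∷ evs) =
    eventually-map (λ (r , rs) → cong₂ _∷_ r rs) (run-complete ev ∧ᵉ runAll-complete evs)

eval-deterministic : ∀ {n} {a : PRF n} {xs v w} → Eval a xs v → Eval a xs w → v ≡ w
eval-deterministic ev ev′ with run-complete ev ∧ᵉ run-complete ev′
... | t , both = let r , r′ = both (≤-refl {t}) in suc-injective (trans (sym r) r′)

least-witness : ∀ {P : ℕ → Set} → U.Decidable P → ∀ {m} → P m →
                ∃ λ n → P n × (∀ z → z < n → ¬ P z)
least-witness {P} P? {m} pm = go (<-wellFounded m) pm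
  where
  go : ∀ {m} → Acc _<_ m → P m → ∃ λ n → P n × (∀ z → z < n → ¬ P z)
  go {m} (acc smaller) pm with anyUpTo? P? m
  ... | yes (z , z<m , pz) = go (smaller z<m) pz
  ... | no  none           = m , pm , λ z z<m pz → none (z , z<m , pz)

mu-minimises : ∀ {n g} (G : Computable (suc n) g) xs {m₀} → g (m₀ ∷ xs) ≡ 0 →
               ∃ λ m → g (m ∷ xs) ≡ 0 × Eval (mu (proj₁ G)) xs m
mu-minimises {g = g} (c , ok) xs g≡0 with least-witness (λ z → g (z ∷ xs) ≟ 0) g≡0
... | m , gm≡0 , below = m , gm≡0 , ev-mu (subst (Eval c (m ∷ xs)) gm≡0 (ok (m ∷ xs))) positive
  where
  positive : ∀ z → z < m → ∃ λ w → Eval c (z ∷ xs) (suc w)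
  positive z z<m with g (z ∷ xs) in gz
  ... | zero  = ⊥-elim (below z z<m gz)
  ... | suc w = w , subst (Eval c (z ∷ xs)) gz (ok (z ∷ xs))

isZero : ℕ → ℕ
isZero zero    = 1
isZero (suc _) = 0

isZero≡0⇒≡suc : ∀ {m} → isZero m ≡ 0 → ∃ λ v → m ≡ suc v
isZero≡0⇒≡suc {suc v} _ = v , refl

isZeroᶜ : Computable 1 (isZero ∘ head)
isZeroᶜ = Computable-≗ (ifZeroᶜ (projᶜ zero) (constᶜ 1) (constᶜ 0))
                       λ { (zero ∷ []) → refl ; (suc _ ∷ []) → refl }

firstNonZero : ∀ {k} → Vec ℕ k → ℕ
firstNonZero []       = 0
firstNonZero (c ∷ cs) = ifZero c (firstNonZero cs) c

firstNonZeroᶜ : ∀ k → Computable k firstNonZero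
firstNonZeroᶜ zero    = Computable-≗ (constᶜ 0) λ { [] → refl }
firstNonZeroᶜ (suc k) =
  Computable-≗ (ifZeroᶜ (projᶜ zero) (firstNonZeroᶜ k ∘ᶜ dropᶜ 1) (projᶜ zero)) λ { (_ ∷ _) → refl }

lookup≡suc⇒firstNonZero≡suc : ∀ {k} (cs : Vec ℕ k) j {w} → lookup cs j ≡ suc w →
                              ∃ λ v → firstNonZero cs ≡ suc v
lookup≡suc⇒firstNonZero≡suc (suc c ∷ cs) _       _  = c , refl
lookup≡suc⇒firstNonZero≡suc (zero  ∷ cs) (suc j) cⱼ = lookup≡suc⇒firstNonZero≡suc cs j cⱼ

firstNonZero≡suc⇒lookup≡suc : ∀ {k} (cs : Vec ℕ k) {v} → firstNonZero cs ≡ suc v →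
                              ∃ λ j → lookup cs j ≡ suc v
firstNonZero≡suc⇒lookup≡suc (zero  ∷ cs) first =
  let j , cⱼ = firstNonZero≡suc⇒lookup≡suc cs first in suc j , cⱼ
firstNonZero≡suc⇒lookup≡suc (suc _ ∷ cs) first = zero , first

lookup-runAll-tabulate : ∀ {k m} (b : Fin k → PRF m) t xs j →
                         lookup (runAll (tabulate b) t xs) j ≡ run (b j) t xs
lookup-runAll-tabulate b t xs zero    = refl
lookup-runAll-tabulate b t xs (suc j) = lookup-runAll-tabulate (b ∘ suc) t xs j

module Dovetail {n k} (b : Fin k → PRF n) where

  firstResult : Computable (suc n) λ v → firstNonZero (runAll (tabulate b) (head v) (tail v))
  firstResult = firstNonZeroᶜ k ∘ᶜ clocks (tabulate b)

  noResult : Computable (suc n) λ v → isZero (firstNonZero (runAll (tabulate b) (head v) (tail v)))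
  noResult = isZeroᶜ ∘ᶜ (firstResult ∷ᶜ []ᶜ)

  dovetail : PRF n
  dovetail = comp (proj₁ predᶜ) (comp (proj₁ firstResult) (mu (proj₁ noResult) ∷ proj₁ idᶜ) ∷ [])

  dovetail-halts : ∀ {xs j w} → Eval (b j) xs w → ∃₂ λ i v → Eval (b i) xs v × Eval dovetail xs v
  dovetail-halts {xs} {j} ev =
    let t₀ , r = run-complete ev
        _ , some = lookup≡suc⇒firstNonZero≡suc (runAll (tabulate b) t₀ xs) j
                     (trans (lookup-runAll-tabulate b t₀ xs j) (r ≤-refl))
        m , found , evμ = mu-minimises noResult xs (cong isZero some)
        v , first = isZero≡0⇒≡suc found
        i , rᵢ = firstNonZero≡suc⇒lookup≡suc (runAll (tabulate b) m xs) first
        evFirst = subst (Eval (proj₁ firstResult) (m ∷ xs)) first (proj₂ firstResult (m ∷ xs))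
    in i , v , run-sound (b i) m xs (trans (sym (lookup-runAll-tabulate b m xs i)) rᵢ) ,
       ev-comp (ev-comp (evμ ∷ proj₂ idᶜ xs) evFirst ∷ []) (proj₂ predᶜ (suc v ∷ []))

open Dovetail using (dovetail; dovetail-halts)

both : ∀ {n} → PRF n → PRF n → PRF n
both a e = comp (proj (suc zero)) (a ∷ e ∷ [])

both-intro : ∀ {n} {a e : PRF n} {xs u v} → Eval a xs u → Eval e xs v → Eval (both a e) xs v
both-intro evₐ evₑ = ev-comp (evₐ ∷ evₑ ∷ []) ev-proj

both-elim : ∀ {n} {a e : PRF n} {xs v} → Eval (both a e) xs v → (∃ λ u → Eval a xs u) × Eval e xs v
both-elim (ev-comp (evₐ ∷ evₑ ∷ []) ev-proj) = (_ , evₐ) , evₑ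

corollary2p3 : (n : ℕ) → 1 ≤ n → (k : ℕ) → (𝒜 : Fin k → Subset n) →
    (∀ i → IsRE (𝒜 i)) → StronglyJoinPermitting (PotPR {n}) 𝒜
corollary2p3 n _ k 𝒜 re f _ covered f↾𝒜-potPR = dovetail joint , extends
  where
  joint : Fin k → PRF n
  joint i = both (proj₁ (re i)) (proj₁ (f↾𝒜-potPR i))
  extends : ∀ x y → f x y → Eval (dovetail joint) x y
  extends x y fxy =
    let j , x∈𝒜ⱼ = covered x y fxy
        _ , domainⱼ = proj₁ (proj₂ (re j) x) x∈𝒜ⱼ
        extensionⱼ = proj₂ (f↾𝒜-potPR j) x y (x∈𝒜ⱼ , fxy)
        i , v , jointᵢ , ev = dovetail-halts joint (both-intro domainⱼ extensionⱼ)
        domainᵢ , extensionᵢ = both-elim jointᵢ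
        x∈𝒜ᵢ = proj₂ (proj₂ (re i) x) domainᵢ
        v≡y = eval-deterministic extensionᵢ (proj₂ (f↾𝒜-potPR i) x y (x∈𝒜ᵢ , fxy))
    in subst (Eval (dovetail joint) x) v≡y ev
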